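{- Let $n,q$ be positive integers and let $s_1,\dots,s_q\ge0$ be integers with $\frac{q(q+1)}{2}+\sum_{k=1}^q k\,s_k=n$. Let $\overline{\alpha}_i=q-i+1+\sum_{k=i}^q s_k$ for $1\le i\le q$. Then (1) $\overline{\alpha}=(\overline{\alpha}_1,\dots,\overline{\alpha}_q)\in\mathcal{P}(n)$; (2) $\overline{\alpha}_1>\overline{\alpha}_2>\dots>\overline{\alpha}_q$; (3) $\delta(\overline{\alpha})=\big(1,2,\dots,q-1,q,q^{(s_q)},(q-1)^{(s_{q-1})},\dots,1^{(s_1)}\big)$; (4) $s_i=\overline{\alpha}_i-\overline{\alpha}_{i+1}-1$ for $1\le i\le q-1$, and $s_q=\overline{\alpha}_q-1$.
   Context: $\mathcal{P}(n)$ is the set of partitions $\alpha=(\alpha_1\ge\dots\ge\alpha_t\ge1)$ of $n$, with $\alpha_i=0$ for $i>t$. The diagonal sequence is $\delta(\alpha)=(d_k)_{k\ge1}$ with $d_k=\big|\{i:1\le i\le k,\ \alpha_i+i-1\ge k\}\big|$, trailing zeros omitted. The notation $m^{(s)}$ means $s$ consecutive entries equal to $m$ (none if $s=0$). -}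

module Defs where

open import Data.Nat using (ℕ; zero; suc; _+_; _*_; _∸_; _≤_; _≥_; _≤?_)
open import Data.List using (List; []; _∷_; map; upTo; length; filter; reverse; dropWhile; concatMap; replicate; _++_)
open import Data.Nat.ListAction using (sum)
open import Data.List.Relation.Unary.All using (All)
open import Data.List.Relation.Unary.Linked using (Linked)
open import Data.Product using (_×_)
open import Relation.Binary.PropositionalEquality using (_≡_)
open import Relation.Nullary.Decidable using (does)
open import Data.Bool using (true; false)
open import Data.Nat using (_≟_)

-- the list [a, a+1, ..., b]  (empty if b < a)
range : ℕ → ℕ → List ℕ
range a b = map (a +_) (upTo (suc b ∸ a))

ΣR : ℕ → ℕ → (ℕ → ℕ) → ℕ
ΣR a b f = sum (map f (range a b))

IsPartition : ℕ → List ℕ → Set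
IsPartition n α = All (1 ≤_) α × Linked _≥_ α × sum α ≡ n

-- 1-based entry α_i, with α_i = 0 for i > t (and for the unused index 0)
at : List ℕ → ℕ → ℕ
at []      _             = 0
at (x ∷ α) zero          = 0
at (x ∷ α) (suc zero)    = x
at (x ∷ α) (suc (suc i)) = at α (suc i)

diag : List ℕ → ℕ → ℕ
diag α k = length (filter (λ i → k ≤? at α i + i ∸ 1) (range 1 k))

dropTrailingZeros : List ℕ → List ℕ
dropTrailingZeros xs = reverse (dropWhile (λ x → x ≟ 0) (reverse xs))

-- δ(α) = (d_k)_{k ≥ 1} with trailing zeros omitted.  d_k = 0 for every
-- k ≥ α₁ + t (t = length α), so it suffices to list d_1, …, d_{α₁+t}.
δ : List ℕ → List ℕ
δ α = dropTrailingZeros (map (diag α) (range 1 (at α 1 + length α)))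

αbar : ℕ → (ℕ → ℕ) → ℕ → ℕ
αbar q s i = q ∸ i + 1 + ΣR i q s

αbarList : ℕ → (ℕ → ℕ) → List ℕ
αbarList q s = map (αbar q s) (range 1 q)

targetδ : ℕ → (ℕ → ℕ) → List ℕ
targetδ q s = range 1 q ++ concatMap (λ k → replicate (s k) k) (reverse (range 1 q))

-- Write S_i = s_i + ⋯ + s_q, so that ᾱ_i = (q − i + 1) + S_i. Row i ≤ q of ᾱ then
-- reaches up to diagonal ᾱ_i + i − 1 = q + S_i, while the rows below q are empty.
-- Hence d_k = k for k ≤ q, and d_{q+j} = #{i ≤ q : S_i ≥ j} is the j-th part of the
-- conjugate of the partition (S_1 ≥ ⋯ ≥ S_q), which is q^(s_q) (q−1)^(s_{q−1}) ⋯ 1^(s_1).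
-- Parts (2) and (4) are the recursion ᾱ_i = s_i + ᾱ_{i+1} + 1, and
-- |ᾱ| = (q + ⋯ + 1) + Σ_i S_i = q(q+1)/2 + Σ_k k s_k.
module Submission where

open import Defs
open import Data.List using (List; []; _∷_; _++_; [_]; map; length; filter; reverse; dropWhile; concatMap; replicate; applyUpTo)
open import Data.List.Properties
  using (map-++; map-∘; map-id; map-cong; map-cong-local; map-upTo; map-replicate; length-map; length-++; ++-assoc; ++-identityʳ;
         concatMap-++; unfold-reverse; reverse-++; reverse-involutive; filter-++; filter-all; filter-none; filter-accept; filter-reject)
open import Data.List.Relation.Unary.All as All using (All; []; _∷_)
open import Data.List.Relation.Unary.All.Properties using (++⁺; map⁺; replicate⁺)
open import Data.List.Relation.Unary.Linked using (Linked; []; [-]; _∷_)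
open import Data.List.Relation.Binary.Permutation.Propositional using (↭-sym)
open import Data.List.Relation.Binary.Permutation.Propositional.Properties using (All-resp-↭; ↭-reverse)
open import Data.Nat using (ℕ; zero; suc; _+_; _*_; _∸_; _/_; _≤_; _<_; _≥_; _≤?_; _≟_; z≤n; s≤s; z<s)
open import Data.Nat.Properties
open import Data.Nat.DivMod using (m*n/n≡m)
open import Data.Nat.ListAction using (sum)
open import Data.Nat.Tactic.RingSolver using (solve-∀)
open import Data.Product using (_×_; _,_)
open import Function using (id; _∘_; _⇔_; mk⇔; Equivalence)
open import Relation.Nullary using (¬_; yes; no; contradiction)
open import Relation.Unary using (Decidable; ∁)
open import Relation.Binary.PropositionalEquality hiding ([_])
open ≡-Reasoning

segment : ℕ → ℕ → List ℕ
segment a zero    = []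
segment a (suc m) = a ∷ segment (suc a) m

length-segment : ∀ a m → length (segment a m) ≡ m
length-segment a zero    = refl
length-segment a (suc m) = cong suc (length-segment (suc a) m)

segment-++ : ∀ a m n → segment a (m + n) ≡ segment a m ++ segment (a + m) n
segment-++ a zero    n = cong (λ b → segment b n) (sym (+-identityʳ a))
segment-++ a (suc m) n = cong (a ∷_) (begin
  segment (suc a) (m + n)                    ≡⟨ segment-++ (suc a) m n ⟩
  segment (suc a) m ++ segment (suc a + m) n ≡⟨ cong (λ b → segment (suc a) m ++ segment b n) (+-suc a m) ⟨
  segment (suc a) m ++ segment (a + suc m) n ∎)

map-+-segment : ∀ a b m → map (_+ a) (segment b m) ≡ segment (b + a) m
map-+-segment a b zero    = refl
map-+-segment a b (suc m) = cong (b + a ∷_) (map-+-segment a (suc b) m)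

map-segment-suc : ∀ {A : Set} (f : ℕ → A) a m → map f (segment (suc a) m) ≡ map (f ∘ suc) (segment a m)
map-segment-suc f a zero    = refl
map-segment-suc f a (suc m) = cong (f (suc a) ∷_) (map-segment-suc f (suc a) m)

applyUpTo-segment : ∀ (f : ℕ → ℕ) a m → (∀ i → f i ≡ a + i) → applyUpTo f m ≡ segment a m
applyUpTo-segment f a zero    f≗a+ = refl
applyUpTo-segment f a (suc m) f≗a+ =
  cong₂ _∷_ (trans (f≗a+ 0) (+-identityʳ a))
            (applyUpTo-segment (f ∘ suc) (suc a) m (λ i → trans (f≗a+ (suc i)) (+-suc a i)))

range-segment : ∀ a b → range a b ≡ segment a (suc b ∸ a)
range-segment a b = trans (map-upTo (a +_) (suc b ∸ a)) (applyUpTo-segment (a +_) a (suc b ∸ a) (λ _ → refl))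

segment⁺ : ∀ {P : ℕ → Set} a m → (∀ {i} → a ≤ i → i < a + m → P i) → All P (segment a m)
segment⁺ a zero    P-in = []
segment⁺ a (suc m) P-in =
  P-in ≤-refl (m<m+n a z<s)
  ∷ segment⁺ (suc a) m (λ {i} a<i i<1+a+m → P-in (<⇒≤ a<i) (subst (i <_) (sym (+-suc a m)) i<1+a+m))

linked-map-segment : ∀ {R : ℕ → ℕ → Set} (f : ℕ → ℕ) a m →
                     (∀ {i} → a ≤ i → i < a + m → R (f i) (f (suc i))) → Linked R (map f (segment a (suc m)))
linked-map-segment f a zero    R-in = [-]
linked-map-segment f a (suc m) R-in =
  R-in ≤-refl (m<m+n a z<s)
  ∷ linked-map-segment f (suc a) m (λ {i} a<i i<1+a+m → R-in (<⇒≤ a<i) (subst (i <_) (sym (+-suc a m)) i<1+a+m))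

at-map-segment : ∀ (f : ℕ → ℕ) m i → 1 ≤ i → i ≤ m → at (map f (segment 1 m)) i ≡ f i
at-map-segment f (suc m) 1             _ _           = refl
at-map-segment f (suc m) (suc (suc i)) _ (s≤s i<m) =
  trans (cong (λ α → at α (suc i)) (map-segment-suc f 1 m)) (at-map-segment (f ∘ suc) m (suc i) (s≤s z≤n) i<m)

at-map-segment-beyond : ∀ (f : ℕ → ℕ) m i → m < i → at (map f (segment 1 m)) i ≡ 0
at-map-segment-beyond f zero    i             _                 = refl
at-map-segment-beyond f (suc m) (suc (suc i)) (s≤s (s≤s m≤i)) =
  trans (cong (λ α → at α (suc i)) (map-segment-suc f 1 m)) (at-map-segment-beyond (f ∘ suc) m (suc i) (s≤s m≤i))

map-const-local : ∀ {A : Set} {f : A → ℕ} {c xs} → All (λ x → f x ≡ c) xs → map f xs ≡ replicate (length xs) c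
map-const-local []           = refl
map-const-local (fx≡c ∷ fxs) = cong₂ _∷_ fx≡c (map-const-local fxs)

count : ∀ {A : Set} {P : A → Set} → Decidable P → List A → ℕ
count P? xs = length (filter P? xs)

module _ {A : Set} {P : A → Set} (P? : Decidable P) where

  count-++ : ∀ xs ys → count P? (xs ++ ys) ≡ count P? xs + count P? ys
  count-++ xs ys = trans (cong length (filter-++ P? xs ys)) (length-++ (filter P? xs))

  count-all : ∀ {xs} → All P xs → count P? xs ≡ length xs
  count-all = cong length ∘ filter-all P?

  count-none : ∀ {xs} → All (∁ P) xs → count P? xs ≡ 0
  count-none = cong length ∘ filter-none P?

  count-accept : ∀ {x xs} → P x → count P? (x ∷ xs) ≡ suc (count P? xs)
  count-accept = cong length ∘ filter-accept P?

  count-reject : ∀ {x xs} → ¬ P x → count P? (x ∷ xs) ≡ count P? xs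
  count-reject = cong length ∘ filter-reject P?

  count-map : ∀ {B : Set} (f : B → A) xs → count P? (map f xs) ≡ count (P? ∘ f) xs
  count-map f []       = refl
  count-map f (x ∷ xs) with P? (f x)
  ... | yes _ = cong suc (count-map f xs)
  ... | no  _ = count-map f xs

  count-cong-local : ∀ {Q : A → Set} (Q? : Decidable Q) {xs} → All (λ x → P x ⇔ Q x) xs → count P? xs ≡ count Q? xs
  count-cong-local Q? []                  = refl
  count-cong-local Q? (_∷_ {x} P⇔Q P⇔Qs) with P? x | Q? x
  ... | yes _  | yes _  = cong suc (count-cong-local Q? P⇔Qs)
  ... | no  _  | no  _  = count-cong-local Q? P⇔Qs
  ... | yes px | no ¬qx = contradiction (Equivalence.to P⇔Q px) ¬qx
  ... | no ¬px | yes qx = contradiction (Equivalence.from P⇔Q qx) ¬px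

dropWhile-++-all : ∀ {A : Set} {P : A → Set} (P? : Decidable P) {zs} ys → All P zs → dropWhile P? (zs ++ ys) ≡ dropWhile P? ys
dropWhile-++-all P? ys []                = refl
dropWhile-++-all P? ys (_∷_ {x} px pzs) with P? x
... | yes _   = dropWhile-++-all P? ys pzs
... | no  ¬px = contradiction px ¬px

dropWhile-none : ∀ {A : Set} {P : A → Set} (P? : Decidable P) {ys} → All (∁ P) ys → dropWhile P? ys ≡ ys
dropWhile-none P? []                 = refl
dropWhile-none P? (_∷_ {y} ¬py _) with P? y
... | yes py = contradiction py ¬py
... | no  _  = refl

dropTrailingZeros-++-replicate : ∀ xs r → All (1 ≤_) xs → dropTrailingZeros (xs ++ replicate r 0) ≡ xs
dropTrailingZeros-++-replicate xs r xs-pos = begin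
  reverse (dropWhile (_≟ 0) (reverse (xs ++ replicate r 0)))      ≡⟨ cong (reverse ∘ dropWhile (_≟ 0)) (reverse-++ xs (replicate r 0)) ⟩
  reverse (dropWhile (_≟ 0) (reverse (replicate r 0) ++ reverse xs)) ≡⟨ cong reverse (dropWhile-++-all (_≟ 0) (reverse xs) zeros) ⟩
  reverse (dropWhile (_≟ 0) (reverse xs))                         ≡⟨ cong reverse (dropWhile-none (_≟ 0) nonzeros) ⟩
  reverse (reverse xs)                                            ≡⟨ reverse-involutive xs ⟩
  xs                                                              ∎
  where
  zeros : All (_≡ 0) (reverse (replicate r 0))
  zeros = All-resp-↭ (↭-sym (↭-reverse (replicate r 0))) (replicate⁺ r refl)
  nonzeros : All (∁ (_≡ 0)) (reverse xs)
  nonzeros = All-resp-↭ (↭-sym (↭-reverse xs)) (All.map n>0⇒n≢0 xs-pos)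

suffixSums : List ℕ → List ℕ
suffixSums []       = []
suffixSums (x ∷ xs) = x + sum xs ∷ suffixSums xs

-- staircase a (x₁, …, xₘ) = (a+m−1)^(xₘ) ⋯ (a+1)^(x₂) a^(x₁); for a = 1 it is the
-- conjugate of the partition suffixSums (x₁, …, xₘ).
staircase : ℕ → List ℕ → List ℕ
staircase a []       = []
staircase a (x ∷ xs) = staircase (suc a) xs ++ replicate x a

map-suc-staircase : ∀ a xs → map suc (staircase a xs) ≡ staircase (suc a) xs
map-suc-staircase a []       = refl
map-suc-staircase a (x ∷ xs) =
  trans (map-++ suc (staircase (suc a) xs) (replicate x a))
        (cong₂ _++_ (map-suc-staircase (suc a) xs) (map-replicate suc x a))

staircase-positive : ∀ a xs → All (1 ≤_) (staircase (suc a) xs)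
staircase-positive a []       = []
staircase-positive a (x ∷ xs) = ++⁺ (staircase-positive (suc a) xs) (replicate⁺ x (s≤s z≤n))

staircase-map-segment : ∀ (s : ℕ → ℕ) a m →
                        staircase a (map s (segment a m)) ≡ concatMap (λ k → replicate (s k) k) (reverse (segment a m))
staircase-map-segment s a zero    = refl
staircase-map-segment s a (suc m) = begin
  staircase (suc a) (map s (segment (suc a) m)) ++ G a ≡⟨ cong (_++ G a) (staircase-map-segment s (suc a) m) ⟩
  concatMap G (reverse (segment (suc a) m)) ++ G a     ≡⟨ cong (concatMap G (reverse (segment (suc a) m)) ++_) (++-identityʳ (G a)) ⟨
  concatMap G (reverse (segment (suc a) m)) ++ concatMap G [ a ] ≡⟨ concatMap-++ G (reverse (segment (suc a) m)) [ a ] ⟨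
  concatMap G (reverse (segment (suc a) m) ++ [ a ])   ≡⟨ cong (concatMap G) (unfold-reverse a (segment (suc a) m)) ⟨
  concatMap G (reverse (segment a (suc m)))            ∎
  where
  G : ℕ → List ℕ
  G k = replicate (s k) k

count-suffixSums-above : ∀ xs {j} → sum xs < j → count (j ≤?_) (suffixSums xs) ≡ 0
count-suffixSums-above []       _    = refl
count-suffixSums-above (x ∷ xs) {j} σ<j =
  trans (count-reject (j ≤?_) (<⇒≱ σ<j)) (count-suffixSums-above xs (≤-<-trans (m≤n+m (sum xs) x) σ<j))

conjugate-suffixSums : ∀ xs → map (λ j → count (j ≤?_) (suffixSums xs)) (segment 1 (sum xs)) ≡ staircase 1 xs
conjugate-suffixSums []       = refl
conjugate-suffixSums (x ∷ xs) = begin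
  map c (segment 1 (x + σ))                        ≡⟨ cong (map c ∘ segment 1) (+-comm x σ) ⟩
  map c (segment 1 (σ + x))                        ≡⟨ cong (map c) (segment-++ 1 σ x) ⟩
  map c (segment 1 σ ++ segment (suc σ) x)         ≡⟨ map-++ c (segment 1 σ) (segment (suc σ) x) ⟩
  map c (segment 1 σ) ++ map c (segment (suc σ) x) ≡⟨ cong₂ _++_ lower upper ⟩
  staircase 2 xs ++ replicate x 1                  ∎
  where
  σ = sum xs
  c c′ : ℕ → ℕ
  c  j = count (j ≤?_) (suffixSums (x ∷ xs))
  c′ j = count (j ≤?_) (suffixSums xs)
  head-counted : ∀ {j} → j ≤ x + σ → c j ≡ suc (c′ j)
  head-counted {j} = count-accept (j ≤?_)
  lower : map c (segment 1 σ) ≡ staircase 2 xs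
  lower = begin
    map c (segment 1 σ)            ≡⟨ map-cong-local (segment⁺ 1 σ (λ _ j≤σ → head-counted (≤-trans (≤-pred j≤σ) (m≤n+m σ x)))) ⟩
    map (suc ∘ c′) (segment 1 σ)   ≡⟨ map-∘ (segment 1 σ) ⟩
    map suc (map c′ (segment 1 σ)) ≡⟨ cong (map suc) (conjugate-suffixSums xs) ⟩
    map suc (staircase 1 xs)       ≡⟨ map-suc-staircase 1 xs ⟩
    staircase 2 xs                 ∎
  upper : map c (segment (suc σ) x) ≡ replicate x 1
  upper = trans (map-const-local (segment⁺ (suc σ) x (λ {j} σ<j j≤σ+x →
                  trans (head-counted (subst (j ≤_) (+-comm σ x) (≤-pred j≤σ+x))) (cong suc (count-suffixSums-above xs σ<j)))))
                (cong (λ n → replicate n 1) (length-segment (suc σ) x))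

conjugate-suffixSums-padded : ∀ xs r →
  map (λ j → count (j ≤?_) (suffixSums xs)) (segment 1 (sum xs + r)) ≡ staircase 1 xs ++ replicate r 0
conjugate-suffixSums-padded xs r = begin
  map c (segment 1 (σ + r))                        ≡⟨ cong (map c) (segment-++ 1 σ r) ⟩
  map c (segment 1 σ ++ segment (suc σ) r)         ≡⟨ map-++ c (segment 1 σ) (segment (suc σ) r) ⟩
  map c (segment 1 σ) ++ map c (segment (suc σ) r) ≡⟨ cong₂ _++_ (conjugate-suffixSums xs) zeros ⟩
  staircase 1 xs ++ replicate r 0                  ∎
  where
  σ = sum xs
  c : ℕ → ℕ
  c j = count (j ≤?_) (suffixSums xs)
  zeros : map c (segment (suc σ) r) ≡ replicate r 0
  zeros = trans (map-const-local (segment⁺ (suc σ) r (λ σ<j _ → count-suffixSums-above xs σ<j)))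
                (cong (λ n → replicate n 0) (length-segment (suc σ) r))

suffixSums-map-segment : ∀ (s : ℕ → ℕ) a m →
  suffixSums (map s (segment a m)) ≡ map (λ i → sum (map s (segment i (a + m ∸ i)))) (segment a m)
suffixSums-map-segment s a zero    = refl
suffixSums-map-segment s a (suc m) = cong₂ _∷_
  (sym (cong (sum ∘ map s ∘ segment a) (m+n∸m≡n a (suc m))))
  (trans (suffixSums-map-segment s (suc a) m)
         (cong (λ b → map (λ i → sum (map s (segment i (b ∸ i)))) (segment (suc a) m)) (sym (+-suc a m))))

sum-map-+ : ∀ {A : Set} (f g : A → ℕ) xs → sum (map (λ x → f x + g x) xs) ≡ sum (map f xs) + sum (map g xs)
sum-map-+ f g []       = refl
sum-map-+ f g (x ∷ xs) = trans (cong (f x + g x +_) (sum-map-+ f g xs)) (interchange (f x) (g x) _ _)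
  where
  interchange : ∀ a b c d → a + b + (c + d) ≡ a + c + (b + d)
  interchange = solve-∀

sum-countdown : ∀ q → sum (map (λ i → q ∸ i + 1) (segment 1 q)) * 2 ≡ q * (q + 1)
sum-countdown zero    = refl
sum-countdown (suc q) = begin
  (q + 1 + sum (map (λ i → suc q ∸ i + 1) (segment 2 q))) * 2 ≡⟨ cong (λ xs → (q + 1 + sum xs) * 2) (map-segment-suc _ 1 q) ⟩
  (q + 1 + sum (map (λ i → q ∸ i + 1) (segment 1 q))) * 2    ≡⟨ *-distribʳ-+ 2 (q + 1) _ ⟩
  (q + 1) * 2 + sum (map (λ i → q ∸ i + 1) (segment 1 q)) * 2 ≡⟨ cong ((q + 1) * 2 +_) (sum-countdown q) ⟩
  (q + 1) * 2 + q * (q + 1)                                  ≡⟨ triangle q ⟩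
  suc q * (suc q + 1)                                        ∎
  where
  triangle : ∀ q → (q + 1) * 2 + q * (q + 1) ≡ suc q * (suc q + 1)
  triangle = solve-∀

sum-suffixSums : ∀ (s : ℕ → ℕ) a m →
  a * sum (map s (segment (suc a) m)) + sum (suffixSums (map s (segment (suc a) m)))
    ≡ sum (map (λ k → k * s k) (segment (suc a) m))
sum-suffixSums s a zero    = trans (+-identityʳ (a * 0)) (*-zeroʳ a)
sum-suffixSums s a (suc m) = begin
  a * (x + σ) + (x + σ + T) ≡⟨ regroup a x σ T ⟩
  suc a * x + (suc a * σ + T) ≡⟨ cong (suc a * x +_) (sum-suffixSums s (suc a) m) ⟩
  suc a * x + sum (map (λ k → k * s k) (segment (suc (suc a)) m)) ∎
  where
  x = s (suc a)
  σ = sum (map s (segment (suc (suc a)) m))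
  T = sum (suffixSums (map s (segment (suc (suc a)) m)))
  regroup : ∀ a x σ T → a * (x + σ) + (x + σ + T) ≡ suc a * x + (suc a * σ + T)
  regroup = solve-∀

ΣR-segment : ∀ a b f → ΣR a b f ≡ sum (map f (segment a (suc b ∸ a)))
ΣR-segment a b f = cong (sum ∘ map f) (range-segment a b)

ΣR-step : ∀ (s : ℕ → ℕ) {i q} → i ≤ q → ΣR i q s ≡ s i + ΣR (suc i) q s
ΣR-step s {i} {q} i≤q = begin
  ΣR i q s                                    ≡⟨ ΣR-segment i q s ⟩
  sum (map s (segment i (suc q ∸ i)))         ≡⟨ cong (sum ∘ map s ∘ segment i) (+-∸-assoc 1 i≤q) ⟩
  s i + sum (map s (segment (suc i) (q ∸ i))) ≡⟨ cong (s i +_) (ΣR-segment (suc i) q s) ⟨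
  s i + ΣR (suc i) q s                        ∎

ΣR-empty : ∀ q (s : ℕ → ℕ) → ΣR (suc q) q s ≡ 0
ΣR-empty q s = trans (ΣR-segment (suc q) q s) (cong (sum ∘ map s ∘ segment (suc q)) (n∸n≡0 q))

map-ΣR-segment : ∀ q (s : ℕ → ℕ) → map (λ i → ΣR i q s) (segment 1 q) ≡ suffixSums (map s (segment 1 q))
map-ΣR-segment q s = trans (map-cong (λ i → ΣR-segment i q s) (segment 1 q)) (sym (suffixSums-map-segment s 1 q))

αbar-step : ∀ q (s : ℕ → ℕ) {i} → i < q → s i + αbar q s (suc i) + 1 ≡ αbar q s i
αbar-step q s {i} i<q = begin
  s i + (q ∸ suc i + 1 + ΣR (suc i) q s) + 1   ≡⟨ regroup (s i) (q ∸ suc i) (ΣR (suc i) q s) ⟩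
  suc (q ∸ suc i) + 1 + (s i + ΣR (suc i) q s) ≡⟨ cong₂ (λ d t → d + 1 + t) (+-∸-assoc 1 i<q) (ΣR-step s (<⇒≤ i<q)) ⟨
  q ∸ i + 1 + ΣR i q s                         ∎
  where
  regroup : ∀ a d t → a + (d + 1 + t) + 1 ≡ suc d + 1 + (a + t)
  regroup = solve-∀

αbar-last : ∀ q (s : ℕ → ℕ) → s q + 1 ≡ αbar q s q
αbar-last q s = sym (begin
  q ∸ q + 1 + ΣR q q s                 ≡⟨ cong₂ (λ d t → d + 1 + t) (n∸n≡0 q) (ΣR-step s ≤-refl) ⟩
  1 + (s q + ΣR (suc q) q s)           ≡⟨ cong (λ t → 1 + (s q + t)) (ΣR-empty q s) ⟩
  1 + (s q + 0)                        ≡⟨ cong suc (+-identityʳ (s q)) ⟩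
  1 + s q                              ≡⟨ +-comm 1 (s q) ⟩
  s q + 1                              ∎)

αbar-decreasing : ∀ q (s : ℕ → ℕ) {i} → i < q → αbar q s (suc i) < αbar q s i
αbar-decreasing q s {i} i<q =
  subst (a <_) (trans (+-comm 1 (s i + a)) (αbar-step q s i<q)) (s≤s (m≤n+m a (s i)))
  where a = αbar q s (suc i)

αbar-positive : ∀ q (s : ℕ → ℕ) → All (1 ≤_) (map (αbar q s) (segment 1 q))
αbar-positive q s = map⁺ (All.universal (λ i → ≤-trans (m≤n+m 1 (q ∸ i)) (m≤m+n (q ∸ i + 1) (ΣR i q s))) (segment 1 q))

αbar-linked : ∀ q (s : ℕ → ℕ) → Linked _≥_ (map (αbar q s) (segment 1 q))
αbar-linked zero    s = []
αbar-linked (suc q) s = linked-map-segment (αbar (suc q) s) 1 q (λ _ i<q → <⇒≤ (αbar-decreasing (suc q) s i<q))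

αbar-+-index : ∀ q (s : ℕ → ℕ) {i} → 1 ≤ i → i ≤ q → αbar q s i + i ∸ 1 ≡ q + ΣR i q s
αbar-+-index q s {suc i} _ i<q = begin
  αbar q s (suc i) + suc i ∸ 1           ≡⟨ cong (_∸ 1) (+-suc (αbar q s (suc i)) i) ⟩
  q ∸ suc i + 1 + ΣR (suc i) q s + i     ≡⟨ regroup (q ∸ suc i) i (ΣR (suc i) q s) ⟩
  q ∸ suc i + suc i + ΣR (suc i) q s     ≡⟨ cong (_+ ΣR (suc i) q s) (m∸n+n≡m i<q) ⟩
  q + ΣR (suc i) q s                     ∎
  where
  regroup : ∀ d i t → d + 1 + t + i ≡ d + suc i + t
  regroup = solve-∀

sum-αbar : ∀ q (s : ℕ → ℕ) → sum (map (αbar q s) (segment 1 q)) ≡ q * (q + 1) / 2 + ΣR 1 q (λ k → k * s k)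
sum-αbar q s = begin
  sum (map (αbar q s) (segment 1 q))                       ≡⟨ sum-map-+ (λ i → q ∸ i + 1) (λ i → ΣR i q s) (segment 1 q) ⟩
  sum (map (λ i → q ∸ i + 1) (segment 1 q)) + sum (map (λ i → ΣR i q s) (segment 1 q))
                                                           ≡⟨ cong₂ _+_ countdown suffixes ⟩
  q * (q + 1) / 2 + ΣR 1 q (λ k → k * s k)                 ∎
  where
  countdown : sum (map (λ i → q ∸ i + 1) (segment 1 q)) ≡ q * (q + 1) / 2
  countdown = sym (trans (cong (_/ 2) (sym (sum-countdown q))) (m*n/n≡m _ 2))
  suffixes : sum (map (λ i → ΣR i q s) (segment 1 q)) ≡ ΣR 1 q (λ k → k * s k)
  suffixes = trans (cong sum (map-ΣR-segment q s)) (trans (sum-suffixSums s 0 q) (sym (ΣR-segment 1 q (λ k → k * s k))))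

-- Row i of α meets the diagonals i, …, α_i + i − 1, so d_k counts the rows i ≤ k with lastDiagonal α i ≥ k.
lastDiagonal : List ℕ → ℕ → ℕ
lastDiagonal α i = at α i + i ∸ 1

module _ (q : ℕ) (s : ℕ → ℕ) where

  private
    ᾱ : List ℕ
    ᾱ = map (αbar q s) (segment 1 q)

  lastDiagonal-αbar : ∀ {i} → 1 ≤ i → i ≤ q → lastDiagonal ᾱ i ≡ q + ΣR i q s
  lastDiagonal-αbar {i} 1≤i i≤q =
    trans (cong (λ a → a + i ∸ 1) (at-map-segment (αbar q s) q i 1≤i i≤q)) (αbar-+-index q s 1≤i i≤q)

  lastDiagonal-αbar-beyond : ∀ {i} → q < i → lastDiagonal ᾱ i ≡ i ∸ 1
  lastDiagonal-αbar-beyond {i} q<i = cong (λ a → a + i ∸ 1) (at-map-segment-beyond (αbar q s) q i q<i)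

  diag-αbar-low : ∀ {k} → k ≤ q → diag ᾱ k ≡ k
  diag-αbar-low {k} k≤q = begin
    count P? (range 1 k)   ≡⟨ cong (count P?) (range-segment 1 k) ⟩
    count P? (segment 1 k) ≡⟨ count-all P? (segment⁺ 1 k reached) ⟩
    length (segment 1 k)   ≡⟨ length-segment 1 k ⟩
    k                      ∎
    where
    P? = λ i → k ≤? lastDiagonal ᾱ i
    reached : ∀ {i} → 1 ≤ i → i < 1 + k → k ≤ lastDiagonal ᾱ i
    reached {i} 1≤i (s≤s i≤k) =
      subst (k ≤_) (sym (lastDiagonal-αbar 1≤i (≤-trans i≤k k≤q))) (≤-trans k≤q (m≤m+n q (ΣR i q s)))

  diag-αbar-high : ∀ j → diag ᾱ (j + q) ≡ count (j ≤?_) (suffixSums (map s (segment 1 q)))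
  diag-αbar-high j = begin
    count P? (range 1 (j + q))                           ≡⟨ cong (count P?) (range-segment 1 (j + q)) ⟩
    count P? (segment 1 (j + q))                         ≡⟨ cong (count P? ∘ segment 1) (+-comm j q) ⟩
    count P? (segment 1 (q + j))                         ≡⟨ cong (count P?) (segment-++ 1 q j) ⟩
    count P? (segment 1 q ++ segment (suc q) j)          ≡⟨ count-++ P? (segment 1 q) (segment (suc q) j) ⟩
    count P? (segment 1 q) + count P? (segment (suc q) j) ≡⟨ cong₂ _+_ rows-≤q rows->q ⟩
    count (j ≤?_) (map (λ i → ΣR i q s) (segment 1 q)) + 0 ≡⟨ +-identityʳ _ ⟩
    count (j ≤?_) (map (λ i → ΣR i q s) (segment 1 q))   ≡⟨ cong (count (j ≤?_)) (map-ΣR-segment q s) ⟩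
    count (j ≤?_) (suffixSums (map s (segment 1 q)))     ∎
    where
    P? = λ i → j + q ≤? lastDiagonal ᾱ i
    shifted : ∀ {i} → 1 ≤ i → i < 1 + q → (j + q ≤ lastDiagonal ᾱ i) ⇔ (j ≤ ΣR i q s)
    shifted {i} 1≤i (s≤s i≤q) rewrite lastDiagonal-αbar 1≤i i≤q | +-comm j q =
      mk⇔ (+-cancelˡ-≤ q j (ΣR i q s)) (+-monoʳ-≤ q)
    rows-≤q : count P? (segment 1 q) ≡ count (j ≤?_) (map (λ i → ΣR i q s) (segment 1 q))
    rows-≤q = trans (count-cong-local P? (λ i → j ≤? ΣR i q s) (segment⁺ 1 q shifted))
                    (sym (count-map (j ≤?_) (λ i → ΣR i q s) (segment 1 q)))
    unreached : ∀ {i} → suc q ≤ i → i < suc q + j → ¬ (j + q ≤ lastDiagonal ᾱ i)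
    unreached {suc i} q<i (s≤s i<q+j) j+q≤ =
      <⇒≱ (subst (i <_) (+-comm q j) i<q+j) (subst (j + q ≤_) (lastDiagonal-αbar-beyond q<i) j+q≤)
    rows->q : count P? (segment (suc q) j) ≡ 0
    rows->q = count-none P? (segment⁺ (suc q) j unreached)

  private
    σ : ℕ
    σ = sum (map s (segment 1 q))

  at-1-+-length-αbar : 1 ≤ q → at ᾱ 1 + length ᾱ ≡ q + (σ + q)
  at-1-+-length-αbar 1≤q = begin
    at ᾱ 1 + length ᾱ        ≡⟨ cong₂ _+_ (at-map-segment (αbar q s) q 1 ≤-refl 1≤q)
                                          (trans (length-map (αbar q s) (segment 1 q)) (length-segment 1 q)) ⟩
    q ∸ 1 + 1 + ΣR 1 q s + q ≡⟨ cong₂ (λ a t → a + t + q) (m∸n+n≡m 1≤q) (ΣR-segment 1 q s) ⟩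
    q + σ + q                ≡⟨ +-assoc q σ q ⟩
    q + (σ + q)              ∎

  map-diag-αbar-low : map (diag ᾱ) (segment 1 q) ≡ range 1 q
  map-diag-αbar-low = begin
    map (diag ᾱ) (segment 1 q) ≡⟨ map-cong-local (segment⁺ 1 q (λ _ k<1+q → diag-αbar-low (≤-pred k<1+q))) ⟩
    map id (segment 1 q)       ≡⟨ map-id (segment 1 q) ⟩
    segment 1 q                ≡⟨ range-segment 1 q ⟨
    range 1 q                  ∎

  map-diag-αbar-high : ∀ r → map (diag ᾱ) (segment (suc q) (σ + r))
                             ≡ staircase 1 (map s (segment 1 q)) ++ replicate r 0
  map-diag-αbar-high r = begin
    map (diag ᾱ) (segment (suc q) (σ + r))         ≡⟨ cong (map (diag ᾱ)) (map-+-segment q 1 (σ + r)) ⟨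
    map (diag ᾱ) (map (_+ q) (segment 1 (σ + r)))  ≡⟨ map-∘ (segment 1 (σ + r)) ⟨
    map (λ j → diag ᾱ (j + q)) (segment 1 (σ + r)) ≡⟨ map-cong diag-αbar-high (segment 1 (σ + r)) ⟩
    map (λ j → count (j ≤?_) (suffixSums (map s (segment 1 q)))) (segment 1 (σ + r))
                                                   ≡⟨ conjugate-suffixSums-padded (map s (segment 1 q)) r ⟩
    staircase 1 (map s (segment 1 q)) ++ replicate r 0 ∎

  δ-αbar : 1 ≤ q → δ ᾱ ≡ targetδ q s
  δ-αbar 1≤q = begin
    dropTrailingZeros (map (diag ᾱ) (range 1 (at ᾱ 1 + length ᾱ)))
      ≡⟨ cong (λ n → dropTrailingZeros (map (diag ᾱ) (range 1 n))) (at-1-+-length-αbar 1≤q) ⟩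
    dropTrailingZeros (map (diag ᾱ) (range 1 (q + (σ + q))))
      ≡⟨ cong (dropTrailingZeros ∘ map (diag ᾱ)) (trans (range-segment 1 _) (segment-++ 1 q (σ + q))) ⟩
    dropTrailingZeros (map (diag ᾱ) (segment 1 q ++ segment (suc q) (σ + q)))
      ≡⟨ cong dropTrailingZeros (map-++ (diag ᾱ) (segment 1 q) (segment (suc q) (σ + q))) ⟩
    dropTrailingZeros (map (diag ᾱ) (segment 1 q) ++ map (diag ᾱ) (segment (suc q) (σ + q)))
      ≡⟨ cong dropTrailingZeros (cong₂ _++_ map-diag-αbar-low (map-diag-αbar-high q)) ⟩
    dropTrailingZeros (range 1 q ++ (staircase 1 ss ++ replicate q 0))
      ≡⟨ cong dropTrailingZeros (++-assoc (range 1 q) (staircase 1 ss) (replicate q 0)) ⟨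
    dropTrailingZeros ((range 1 q ++ staircase 1 ss) ++ replicate q 0)
      ≡⟨ dropTrailingZeros-++-replicate (range 1 q ++ staircase 1 ss) q positive ⟩
    range 1 q ++ staircase 1 ss
      ≡⟨ cong (range 1 q ++_) (staircase-map-segment s 1 q) ⟩
    range 1 q ++ concatMap (λ k → replicate (s k) k) (reverse (segment 1 q))
      ≡⟨ cong (λ xs → range 1 q ++ concatMap (λ k → replicate (s k) k) (reverse xs)) (range-segment 1 q) ⟨
    targetδ q s
      ∎
    where
    ss = map s (segment 1 q)
    positive : All (1 ≤_) (range 1 q ++ staircase 1 ss)
    positive = ++⁺ (subst (All (1 ≤_)) (sym (range-segment 1 q)) (segment⁺ 1 q (λ 1≤i _ → 1≤i)))
                   (staircase-positive 0 ss)

αbarList-segment : ∀ q s → αbarList q s ≡ map (αbar q s) (segment 1 q)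
αbarList-segment q s = cong (map (αbar q s)) (range-segment 1 q)

proposition2p3 : (n q : ℕ) → 1 ≤ n → 1 ≤ q → (s : ℕ → ℕ)
    → q * (q + 1) / 2 + ΣR 1 q (λ k → k * s k) ≡ n
    → IsPartition n (αbarList q s)
      × (∀ i → 1 ≤ i → i < q → αbar q s (suc i) < αbar q s i)
      × δ (αbarList q s) ≡ targetδ q s
      × (∀ i → 1 ≤ i → i < q → s i + αbar q s (suc i) + 1 ≡ αbar q s i)
      × s q + 1 ≡ αbar q s q
proposition2p3 n q _ 1≤q s size =
    subst (IsPartition n) (sym (αbarList-segment q s))
          (αbar-positive q s , αbar-linked q s , trans (sum-αbar q s) size)
  , (λ _ _ → αbar-decreasing q s)
  , trans (cong δ (αbarList-segment q s)) (δ-αbar q s 1≤q)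
  , (λ _ _ → αbar-step q s)
  , αbar-last q s
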